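{- Let $G$ be a finite simple connected graph and let $m \in \mathbb{N}$. Suppose there is a map $l : V(G) \to \mathbb{Z}$ such that for every prime $p \ge m$, the map $v \mapsto l(v) \bmod p$ is a $\mathbb{Z}_p$-vertex magic labeling of $G$. Then $G$ is $\mathbb{Z}$-vertex magic.
   Context: For a non-trivial Abelian group $A$, a graph $G$ is $A$-vertex magic if there exist a labeling $l : V(G) \to A\setminus\{0\}$ and $\mu \in A$ such that $\sum_{u \in N_G(v)} l(u) = \mu$ for every vertex $v$ of $G$, where $N_G(v)$ is the open neighborhood of $v$. Such $l$ is called an $A$-vertex magic labeling. -}

module Defs where

open import Data.Nat using (ℕ; suc)
open import Data.Fin using (Fin)
open import Data.Bool using (Bool; true; false; if_then_else_)
open import Data.Integer as ℤ using (ℤ; 0ℤ; _-_)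
open import Data.Integer.Divisibility using (_∣_)
open import Data.List using (List; []; _∷_; foldr; map)
open import Data.List.Base using (allFin)
open import Data.Product using (Σ; ∃; _×_; _,_)
open import Relation.Binary.PropositionalEquality using (_≡_)
open import Relation.Nullary using (¬_)

record Graph (n : ℕ) : Set where
  field
    adj   : Fin n → Fin n → Bool
    sym   : ∀ u v → adj u v ≡ adj v u
    irrfl : ∀ v → adj v v ≡ false
open Graph public

data Walk {n : ℕ} (G : Graph n) : Fin n → Fin n → Set where
  here : ∀ {v} → Walk G v v
  step : ∀ {u w v} → adj G u w ≡ true → Walk G w v → Walk G u v

Connected : ∀ {n} → Graph n → Set
Connected {n} G = ∀ (u v : Fin n) → Walk G u v

nbSum : ∀ {n} → Graph n → (Fin n → ℤ) → Fin n → ℤ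
nbSum {n} G l v =
  foldr ℤ._+_ 0ℤ (map (λ u → if adj G v u then l u else 0ℤ) (allFin n))

ZVertexMagicLabeling : ∀ {n} → Graph n → (Fin n → ℤ) → Set
ZVertexMagicLabeling {n} G l =
  (∀ v → ¬ (l v ≡ 0ℤ)) × ∃ λ (μ : ℤ) → ∀ v → nbSum G l v ≡ μ

ZVertexMagic : ∀ {n} → Graph n → Set
ZVertexMagic {n} G = ∃ λ (l : Fin n → ℤ) → ZVertexMagicLabeling G l

-- v ↦ l(v) mod p is a Z_p-vertex magic labeling: working with integer
-- representatives, this says l(v) ≢ 0 (mod p) for all v, and there is
-- μ with Σ_{u∈N(v)} l(u) ≡ μ (mod p) for all v  (μ ∈ ℤ represents μ mod p).
ZpVertexMagicLabeling : ∀ {n} → ℕ → Graph n → (Fin n → ℤ) → Set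
ZpVertexMagicLabeling {n} p G l =
  (∀ v → ¬ (ℤ.+ p ∣ l v)) × ∃ λ (μ : ℤ) → ∀ v → ℤ.+ p ∣ (nbSum G l v - μ)

-- An integer divisible by infinitely many primes is 0.  By Euclid there are
-- arbitrarily large primes, so a label l(v) that is nonzero modulo every large
-- prime is nonzero, and two neighbourhood sums that are congruent modulo every
-- large prime (both are congruent to that prime's magic constant) are equal.
-- Hence l itself is a ℤ-vertex magic labeling.
module Submission where

open import Defs using (Graph; Connected; nbSum; ZVertexMagic; ZpVertexMagicLabeling)
open import Data.Nat using (ℕ; zero; suc; _≥_; _≤_; _<_; _+_; _!; _≤?_; ≢-nonZero⁻¹)
open import Data.Nat.Primality using (Prime; ¬prime[1]; prime⇒nonZero)
open import Data.Nat.Primality.Factorisation using (factorise)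
open import Data.Nat.ListAction using (product)
open import Data.Fin using (Fin)
open import Data.Integer using (ℤ; 0ℤ; +_; _-_; ∣_∣)
open import Data.Integer.Tactic.RingSolver using (solve-∀)
open import Data.List using ([]; _∷_)
open import Data.List.Relation.Unary.All using (_∷_)
open import Data.Product using (∃; _×_; _,_; proj₁)
open import Data.Empty using (⊥-elim)
open import Relation.Binary.PropositionalEquality using (_≡_; refl; sym; trans; subst)
open import Relation.Nullary using (¬_; yes; no)
import Data.Nat.Properties as ℕ
import Data.Nat.Divisibility as ℕ
import Data.Integer.Properties as ℤ
import Data.Integer.Divisibility as ℤ
import Data.Integer.Divisibility.Signed as ℤˢ

prime∣n! : ∀ {p} n → Prime p → p ≤ n → p ℕ.∣ n !
prime∣n! {zero}  n pr _   = ⊥-elim (≢-nonZero⁻¹ 0 {{prime⇒nonZero pr}} refl)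
prime∣n! {suc q} n _  p≤n = ℕ.∣-trans (ℕ.m∣m*n (q !)) (ℕ.m≤n⇒m!∣n! p≤n)

∃prime> : ∀ n → ∃ λ p → Prime p × n < p
∃prime> n with factorise (suc (n !))
... | record { factors = [] ; isFactorisation = n!+1≡1 } =
  ⊥-elim (ℕ.<⇒≢ (ℕ.1≤n! n) (sym (ℕ.suc-injective n!+1≡1)))
... | record { factors = p ∷ ps ; isFactorisation = eq ; factorsPrime = pr ∷ _ }
  with p ≤? n
...   | no p≰n = p , pr , ℕ.≰⇒> p≰n
...   | yes p≤n = ⊥-elim (¬prime[1] (subst Prime p≡1 pr))
  where
  p∣n!+1 : p ℕ.∣ n ! + 1
  p∣n!+1 = subst (p ℕ.∣_) (trans (sym eq) (ℕ.+-comm 1 (n !))) (ℕ.m∣m*n (product ps))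

  p≡1 : p ≡ 1
  p≡1 = ℕ.∣1⇒≡1 (ℕ.∣m+n∣m⇒∣n p∣n!+1 (prime∣n! n pr p≤n))

∣∧<⇒≡0 : ∀ {p k} → p ℕ.∣ k → k < p → k ≡ 0
∣∧<⇒≡0 {k = zero}  _   _   = refl
∣∧<⇒≡0 {k = suc k} p∣k k<p = ⊥-elim (ℕ.<⇒≱ k<p (ℕ.∣⇒≤ p∣k))

∣largePrimes⇒≡0 : ∀ m {x} → (∀ p → Prime p → p ≥ m → + p ℤ.∣ x) → x ≡ 0ℤ
∣largePrimes⇒≡0 m {x} ∣x with ∃prime> (m + ∣ x ∣)
... | p , pr , m+∣x∣<p = ℤ.∣i∣≡0⇒i≡0 (∣∧<⇒≡0 (∣x p pr m≤p) ∣x∣<p)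
  where
  m≤p : m ≤ p
  m≤p = ℕ.≤-trans (ℕ.m≤m+n m ∣ x ∣) (ℕ.<⇒≤ m+∣x∣<p)

  ∣x∣<p : ∣ x ∣ < p
  ∣x∣<p = ℕ.≤-<-trans (ℕ.m≤n+m ∣ x ∣ m) m+∣x∣<p

∣i-k∧∣j-k⇒∣i-j : ∀ d i j k → d ℤ.∣ i - k → d ℤ.∣ j - k → d ℤ.∣ i - j
∣i-k∧∣j-k⇒∣i-j d i j k d∣i-k d∣j-k =
  subst (d ℤ.∣_) (cancel i j k)
    (ℤˢ.∣⇒∣ᵤ (ℤˢ.∣m∣n⇒∣m-n {d} {i - k} {j - k} (ℤˢ.∣ᵤ⇒∣ d∣i-k) (ℤˢ.∣ᵤ⇒∣ d∣j-k)))
  where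
  cancel : ∀ i j k → (i - k) - (j - k) ≡ i - j
  cancel = solve-∀

allEqual⇒constant : ∀ {n} (f : Fin n → ℤ) → (∀ u v → f u ≡ f v) →
                    ∃ λ μ → ∀ v → f v ≡ μ
allEqual⇒constant {zero}  f _  = 0ℤ , λ ()
allEqual⇒constant {suc n} f eq = f Fin.zero , λ v → eq v Fin.zero

mainTheorem2 : ∀ (n : ℕ) (G : Graph n) → Connected G → (m : ℕ) →
    (l : Fin n → ℤ) →
    (∀ (p : ℕ) → Prime p → p ≥ m → ZpVertexMagicLabeling p G l) →
    ZVertexMagic G
mainTheorem2 n G _ m l magicModp = l , nonzero , allEqual⇒constant (nbSum G l) sumsEqual
  where
  nonzero : ∀ v → ¬ (l v ≡ 0ℤ)
  nonzero v lv≡0 with ∃prime> m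
  ... | p , pr , m<p =
    proj₁ (magicModp p pr (ℕ.<⇒≤ m<p)) v (subst (+ p ℤ.∣_) (sym lv≡0) (p ℕ.∣0))

  sumsEqual : ∀ u v → nbSum G l u ≡ nbSum G l v
  sumsEqual u v = ℤ.i-j≡0⇒i≡j _ _ (∣largePrimes⇒≡0 m λ p pr p≥m →
    let (_ , μ , sums≡μ) = magicModp p pr p≥m
    in ∣i-k∧∣j-k⇒∣i-j (+ p) (nbSum G l u) (nbSum G l v) μ (sums≡μ u) (sums≡μ v))
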